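{- For every positive integer $N$ there exist a connected simple graph $G$ and a vertex $v\in V(G)$ which is not a cut vertex of $G$ such that $|\chi_{dom}(G)-\chi_{dom}(G-v)|\geq N$.
   Context: A dominated coloring of a simple graph $H$ is a proper vertex coloring of $H$ such that every color class is dominated by at least one vertex, i.e. for each color class $C$ there is a vertex $x$ of $H$ adjacent to every vertex of $C$. The dominated chromatic number $\chi_{dom}(H)$ is the minimum number of colors in a dominated coloring of $H$. $G-v$ denotes the graph obtained from $G$ by deleting $v$ and all edges incident with $v$. -}

module Defs where

open import Level using (0ℓ)
open import Data.Nat using (ℕ; suc; _<_)
open import Data.Fin using (Fin; punchIn)
open import Data.Product using (Σ; ∃; _×_; _,_)
open import Relation.Binary.PropositionalEquality using (_≡_; _≢_)
open import Relation.Nullary using (¬_)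

record Graph (n : ℕ) : Set₁ where
  field
    Adj   : Fin n → Fin n → Set
    sym   : ∀ {u w} → Adj u w → Adj w u
    irrefl : ∀ {u} → ¬ Adj u u
open Graph public

_-ᵥ_ : ∀ {n} → Graph (suc n) → Fin (suc n) → Graph n
G -ᵥ v = record
  { Adj    = λ i j → Adj G (punchIn v i) (punchIn v j)
  ; sym    = sym G
  ; irrefl = irrefl G
  }

data Walk {n} (G : Graph n) : Fin n → Fin n → Set where
  here : ∀ {u} → Walk G u u
  step : ∀ {u w x} → Adj G u w → Walk G w x → Walk G u x

Connected : ∀ {n} → Graph n → Set
Connected G = ∀ u w → Walk G u w

-- v is a cut vertex of G iff deleting v increases the number of connected
-- components, i.e. some two vertices other than v that are joined by a walk
-- in G are no longer joined by a walk in G - v.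
IsCutVertex : ∀ {n} → Graph (suc n) → Fin (suc n) → Set
IsCutVertex {n} G v =
  Σ (Fin n) λ a → Σ (Fin n) λ b →
    Walk G (punchIn v a) (punchIn v b) × ¬ Walk (G -ᵥ v) a b

record DominatedColoring {n} (G : Graph n) (k : ℕ) : Set where
  field
    color     : Fin n → Fin k
    proper    : ∀ {u w} → Adj G u w → color u ≢ color w
    dominated : ∀ (i : Fin k) → ∃ λ x → ∀ u → color u ≡ i → Adj G x u

IsDomChromaticNumber : ∀ {n} → Graph n → ℕ → Set
IsDomChromaticNumber G k =
  DominatedColoring G k × (∀ m → m < k → ¬ DominatedColoring G m)

module Submission where

-- The spider S_M (M ≥ 1) has a centre c, inner vertices a₁ … a_M
-- adjacent to c, and leaves l₁ … l_M with l_i adjacent only to a_i.  Let G be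
-- the cone over S_M: a new apex adjacent to every vertex of S_M.  Deleting the
-- apex gives back S_M, which is connected, so the apex is not a cut vertex.
--
--   * χ_dom(S_M) = M + 1.  Two vertices that are adjacent, or that have no
--     common neighbour, never share a colour class of a dominated colouring;
--     a₁, l₁, …, l_M are pairwise of the second kind, giving M + 1 classes,
--     and {a₁ … a_M}, {c , l₁}, {l₂}, …, {l_M} is a dominated colouring.
--   * χ_dom(G) = 3.  The apex with any edge of S_M is a triangle, and
--     apex / the two sides of a bipartition of S_M is a dominated colouring.
--
-- With M = N + 2 the difference is N.

open import Defs
open import Data.Nat using (ℕ; suc; _≤_; ∣_-_∣)
open import Data.Fin using (Fin)
open import Data.Product using (Σ; _×_)
open import Relation.Nullary using (¬_)

open import Data.Nat using (_+_)
open import Data.Nat.Properties using (≤-refl; <⇒≱)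
open import Data.Fin using (zero; suc; splitAt; join; _≟_)
open import Data.Fin.Properties using (splitAt-join; injective⇒≤; suc-injective)
open import Data.Sum using (_⊎_; inj₁; inj₂)
open import Data.Product using (_,_; ∃)
open import Data.Unit using (⊤; tt)
open import Data.Empty using (⊥; ⊥-elim)
open import Relation.Nullary using (yes; no)
open import Relation.Binary.PropositionalEquality
  using (_≡_; _≢_; refl; trans; cong)
  renaming (sym to ≡-sym)

module _ {n : ℕ} {G : Graph n} where

  _++_ : ∀ {u w x} → Walk G u w → Walk G w x → Walk G u x
  here     ++ q = q
  step e p ++ q = step e (p ++ q)

  reverse : ∀ {u w} → Walk G u w → Walk G w u
  reverse here       = here
  reverse (step e p) = reverse p ++ step (sym G e) here

  connected-via-hub : ∀ hub → (∀ u → Walk G u hub) → Connected G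
  connected-via-hub hub toHub u w = toHub u ++ reverse (toHub w)

connected-deletion⇒not-cut : ∀ {n} (G : Graph (suc n)) v →
  Connected (G -ᵥ v) → ¬ IsCutVertex G v
connected-deletion⇒not-cut G v conn (a , b , _ , noWalk) = noWalk (conn a b)

-- x and y are separated by R if they are R-related or have no common
-- R-neighbour.  For R = Adj G neither can happen inside one dominated class.
Separated : {V : Set} → (V → V → Set) → V → V → Set
Separated R x y = R x y ⊎ (∀ z → R z x → ¬ R z y)

module _ {n k : ℕ} {G : Graph n} (dc : DominatedColoring G k) where
  open DominatedColoring dc

  separated⇒distinct-colours : ∀ {u w} → Separated (Adj G) u w → color u ≢ color w
  separated⇒distinct-colours (inj₁ edge) = proper edge
  separated⇒distinct-colours {u} {w} (inj₂ noCommon) same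
    with dominated (color u)
  ... | x , dom = noCommon x (dom u refl) (dom w (≡-sym same))

separated-family⇒≤ : ∀ {n k m} {G : Graph n} (f : Fin k → Fin n) →
  (∀ {i j} → i ≢ j → Separated (Adj G) (f i) (f j)) →
  DominatedColoring G m → k ≤ m
separated-family⇒≤ f apart dc = injective⇒≤ colour-injective
  where
  open DominatedColoring dc
  colour-injective : ∀ {i j} → color (f i) ≡ color (f j) → i ≡ j
  colour-injective {i} {j} same with i ≟ j
  ... | yes i≡j = i≡j
  ... | no  i≢j = ⊥-elim (separated⇒distinct-colours dc (apart i≢j) same)

dom-chromatic : ∀ {n k} {G : Graph n} → DominatedColoring G k →
  (f : Fin k → Fin n) → (∀ {i j} → i ≢ j → Separated (Adj G) (f i) (f j)) →
  IsDomChromaticNumber G k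
dom-chromatic dc f apart =
  dc , λ m m<k dc′ → <⇒≱ m<k (separated-family⇒≤ f apart dc′)

module _ {n : ℕ} (G : Graph n) (x y z : Fin n)
         (xy : Adj G x y) (yz : Adj G y z) (xz : Adj G x z) where

  corner : Fin 3 → Fin n
  corner zero             = x
  corner (suc zero)       = y
  corner (suc (suc zero)) = z

  corners-separated : ∀ {i j} → i ≢ j → Separated (Adj G) (corner i) (corner j)
  corners-separated {zero}             {zero}             i≢j = ⊥-elim (i≢j refl)
  corners-separated {zero}             {suc zero}         _   = inj₁ xy
  corners-separated {zero}             {suc (suc zero)}   _   = inj₁ xz
  corners-separated {suc zero}         {zero}             _   = inj₁ (sym G xy)
  corners-separated {suc zero}         {suc zero}         i≢j = ⊥-elim (i≢j refl)
  corners-separated {suc zero}         {suc (suc zero)}   _   = inj₁ yz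
  corners-separated {suc (suc zero)}   {zero}             _   = inj₁ (sym G xz)
  corners-separated {suc (suc zero)}   {suc zero}         _   = inj₁ (sym G yz)
  corners-separated {suc (suc zero)}   {suc (suc zero)}   i≢j = ⊥-elim (i≢j refl)

-- Given a simple graph R on a label type V and a labelling of Fin n that
-- hits every label (decode ∘ encode ≡ id), the graph on Fin n with
-- u ~ w iff decode u R decode w; facts about R transfer to it.
module Labelled {V : Set} (R : V → V → Set)
                (R-sym : ∀ {x y} → R x y → R y x) (R-irrefl : ∀ {x} → ¬ R x x)
                {n : ℕ} (decode : Fin n → V) (encode : V → Fin n)
                (decode-encode : ∀ x → decode (encode x) ≡ x) where

  graph : Graph n
  graph = record
    { Adj    = λ u w → R (decode u) (decode w)
    ; sym    = λ {u} {w} → R-sym {decode u} {decode w}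
    ; irrefl = λ {u} → R-irrefl {decode u}
    }

  adj : ∀ u w {x y} → decode u ≡ x → decode w ≡ y → R x y → Adj graph u w
  adj _ _ refl refl r = r

  separated : ∀ u w {x y} → decode u ≡ x → decode w ≡ y →
    Separated R x y → Separated (Adj graph) u w
  separated _ _ refl refl (inj₁ r)        = inj₁ r
  separated _ _ refl refl (inj₂ noCommon) = inj₂ λ z → noCommon (decode z)

  coloring : ∀ {k} (col : V → Fin k) →
    (∀ {x y} → R x y → col x ≢ col y) →
    (∀ i → ∃ λ x → ∀ y → col y ≡ i → R x y) →
    DominatedColoring graph k
  coloring col col-proper col-dominated = record
    { color     = λ u → col (decode u)
    ; proper    = col-proper
    ; dominated = dominator
    }
    where
    dominator : ∀ i → ∃ λ x → ∀ u → col (decode u) ≡ i → Adj graph x u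
    dominator i with col-dominated i
    ... | x , dom = encode x , λ u same →
      adj (encode x) u (decode-encode x) refl (dom (decode u) same)

-- The cone over H: a new apex (vertex zero) adjacent to every vertex of H.
-- Its adjacency on vertices suc u, suc w is that of H, so that
-- cone H -ᵥ zero is H by definition.
module _ {n : ℕ} (H : Graph n) where

  ConeAdj : Fin (suc n) → Fin (suc n) → Set
  ConeAdj zero    zero    = ⊥
  ConeAdj zero    (suc _) = ⊤
  ConeAdj (suc _) zero    = ⊤
  ConeAdj (suc u) (suc w) = Adj H u w

  cone-sym : ∀ {u w} → ConeAdj u w → ConeAdj w u
  cone-sym {zero}  {suc _} _ = tt
  cone-sym {suc _} {zero}  _ = tt
  cone-sym {suc _} {suc _} e = sym H e

  cone-irrefl : ∀ {u} → ¬ ConeAdj u u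
  cone-irrefl {suc _} e = irrefl H e

  cone : Graph (suc n)
  cone = record
    { Adj    = ConeAdj
    ; sym    = λ {u} {w} → cone-sym {u} {w}
    ; irrefl = λ {u} → cone-irrefl {u}
    }

  cone-connected : Connected cone
  cone-connected = connected-via-hub zero toApex
    where
    toApex : ∀ u → Walk cone u zero
    toApex zero    = here
    toApex (suc u) = step tt here

  cone-coloring : ∀ {k} → Fin n → (col : Fin n → Fin k) →
    (∀ {u w} → Adj H u w → col u ≢ col w) → DominatedColoring cone (suc k)
  cone-coloring {k} someVertex col col-proper = record
    { color = colour ; proper = colour-proper ; dominated = dominator }
    where
    colour : Fin (suc n) → Fin (suc k)
    colour zero    = zero
    colour (suc u) = suc (col u)

    colour-proper : ∀ {u w} → ConeAdj u w → colour u ≢ colour w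
    colour-proper {zero}  {suc _} _ ()
    colour-proper {suc _} {zero}  _ ()
    colour-proper {suc _} {suc _} e same = col-proper e (suc-injective same)

    dominator : ∀ i → ∃ λ x → ∀ u → colour u ≡ i → ConeAdj x u
    dominator zero    = suc someVertex , λ { zero _ → tt ; (suc _) () }
    dominator (suc _) = zero           , λ { zero () ; (suc _) _ → tt }

  cone-dom-chromatic : ∀ {u w} → Adj H u w → (col : Fin n → Fin 2) →
    (∀ {u w} → Adj H u w → col u ≢ col w) → IsDomChromaticNumber cone 3
  cone-dom-chromatic {u} {w} uw col col-proper =
    dom-chromatic (cone-coloring u col col-proper)
      (corner cone zero (suc u) (suc w) tt uw tt)
      (corners-separated cone zero (suc u) (suc w) tt uw tt)

data SpiderVertex (M : ℕ) : Set where
  centre : SpiderVertex M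
  inner  : Fin M → SpiderVertex M
  leaf   : Fin M → SpiderVertex M

SpiderAdj : ∀ {M} → SpiderVertex M → SpiderVertex M → Set
SpiderAdj centre    (inner _) = ⊤
SpiderAdj (inner _) centre    = ⊤
SpiderAdj (inner i) (leaf j)  = i ≡ j
SpiderAdj (leaf i)  (inner j) = i ≡ j
SpiderAdj _         _         = ⊥

spider-sym : ∀ {M} {x y : SpiderVertex M} → SpiderAdj x y → SpiderAdj y x
spider-sym {x = centre}  {inner _} _ = tt
spider-sym {x = inner _} {centre}  _ = tt
spider-sym {x = inner _} {leaf _}  e = ≡-sym e
spider-sym {x = leaf _}  {inner _} e = ≡-sym e

spider-irrefl : ∀ {M} {x : SpiderVertex M} → ¬ SpiderAdj x x
spider-irrefl {x = centre}  ()
spider-irrefl {x = inner _} ()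
spider-irrefl {x = leaf _}  ()

module Spider (M : ℕ) where

  leg : Fin M ⊎ Fin M → SpiderVertex M
  leg (inj₁ i) = inner i
  leg (inj₂ i) = leaf i

  decode : Fin (suc (M + M)) → SpiderVertex M
  decode zero    = centre
  decode (suc k) = leg (splitAt M k)

  encode : SpiderVertex M → Fin (suc (M + M))
  encode centre    = zero
  encode (inner i) = suc (join M M (inj₁ i))
  encode (leaf i)  = suc (join M M (inj₂ i))

  decode-encode : ∀ x → decode (encode x) ≡ x
  decode-encode centre    = refl
  decode-encode (inner i) = cong leg (splitAt-join M M (inj₁ i))
  decode-encode (leaf i)  = cong leg (splitAt-join M M (inj₂ i))

  open Labelled SpiderAdj spider-sym spider-irrefl decode encode decode-encode public
    renaming (graph to spider)

-- From here on the spider has at least one leg, written suc M.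
module NonemptySpider (M : ℕ) where
  open Spider (suc M) public

  spider-connected : Connected spider
  spider-connected = connected-via-hub hub toHub
    where
    hub : Fin _
    hub = encode (inner zero)

    fromCentre : Walk spider (encode centre) hub
    fromCentre =
      step (adj (encode centre) hub refl (decode-encode (inner zero)) tt) here

    fromInner : ∀ i → Walk spider (encode (inner i)) hub
    fromInner i =
      step (adj (encode (inner i)) (encode centre) (decode-encode (inner i)) refl tt)
           fromCentre

    toHub : ∀ u → Walk spider u hub
    toHub u with decode u in eq
    ... | centre  = step (adj u hub eq (decode-encode (inner zero)) tt) here
    ... | inner _ = step (adj u (encode centre) eq refl tt) fromCentre
    ... | leaf i  =
      step (adj u (encode (inner i)) eq (decode-encode (inner i)) refl) (fromInner i)

  side : SpiderVertex (suc M) → Fin 2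
  side (inner _) = suc zero
  side _         = zero

  side-proper : ∀ {x y} → SpiderAdj x y → side x ≢ side y
  side-proper {centre}  {inner _} _ ()
  side-proper {inner _} {centre}  _ ()
  side-proper {inner _} {leaf _}  _ ()
  side-proper {leaf _}  {inner _} _ ()

  legColour : SpiderVertex (suc M) → Fin (suc (suc M))
  legColour centre    = suc zero
  legColour (inner _) = zero
  legColour (leaf i)  = suc i

  legColour-proper : ∀ {x y} → SpiderAdj x y → legColour x ≢ legColour y
  legColour-proper {centre}  {inner _} _ ()
  legColour-proper {inner _} {centre}  _ ()
  legColour-proper {inner _} {leaf _}  _ ()
  legColour-proper {leaf _}  {inner _} _ ()

  legColour-dominated : ∀ c → ∃ λ x → ∀ y → legColour y ≡ c → SpiderAdj x y
  legColour-dominated zero    = centre , λ { (inner _) _ → tt ; centre () ; (leaf _) () }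
  legColour-dominated (suc i) =
    inner i , λ { centre _ → tt ; (leaf _) refl → refl ; (inner _) () }

  inner-leaf-separated : ∀ (j : Fin (suc M)) → Separated SpiderAdj (inner zero) (leaf j)
  inner-leaf-separated j = inj₂ λ { centre _ () ; (leaf _) _ () }

  leaf-inner-separated : ∀ (j : Fin (suc M)) → Separated SpiderAdj (leaf j) (inner zero)
  leaf-inner-separated j = inj₂ λ { (inner _) _ () }

  leaves-separated : ∀ {i j : Fin (suc M)} → i ≢ j → Separated SpiderAdj (leaf i) (leaf j)
  leaves-separated i≢j = inj₂ λ { (inner _) toI toJ → i≢j (trans (≡-sym toI) toJ) }

  witness : Fin (suc (suc M)) → SpiderVertex (suc M)
  witness zero    = inner zero
  witness (suc i) = leaf i

  witnesses-separated : ∀ {i j} → i ≢ j → Separated SpiderAdj (witness i) (witness j)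
  witnesses-separated {zero}  {zero}  i≢j = ⊥-elim (i≢j refl)
  witnesses-separated {zero}  {suc j} _   = inner-leaf-separated j
  witnesses-separated {suc i} {zero}  _   = leaf-inner-separated i
  witnesses-separated {suc i} {suc j} i≢j = leaves-separated (λ i≡j → i≢j (cong suc i≡j))

  spider-dom-chromatic : IsDomChromaticNumber spider (suc (suc M))
  spider-dom-chromatic =
    dom-chromatic (coloring legColour legColour-proper legColour-dominated)
      (λ i → encode (witness i))
      (λ {i} {j} i≢j → separated (encode (witness i)) (encode (witness j))
         (decode-encode (witness i)) (decode-encode (witness j))
         (witnesses-separated i≢j))

  cone-spider-dom-chromatic : IsDomChromaticNumber (cone spider) 3
  cone-spider-dom-chromatic =
    cone-dom-chromatic spider {encode centre} {encode (inner zero)}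
      (adj (encode centre) (encode (inner zero)) refl (decode-encode (inner zero)) tt)
      (λ u → side (decode u)) side-proper

mainTheorem3 : ∀ (N : ℕ) → 1 ≤ N →
    Σ ℕ λ n → Σ (Graph (suc n)) λ G → Σ (Fin (suc n)) λ v →
      Connected G × ¬ IsCutVertex G v ×
      Σ ℕ λ k₁ → Σ ℕ λ k₂ →
        IsDomChromaticNumber G k₁ × IsDomChromaticNumber (G -ᵥ v) k₂ ×
        N ≤ ∣ k₁ - k₂ ∣
mainTheorem3 N _ =
  _ , cone spider , zero ,
  cone-connected spider ,
  connected-deletion⇒not-cut (cone spider) zero spider-connected ,
  3 , suc (suc (suc N)) ,
  cone-spider-dom-chromatic , spider-dom-chromatic ,
  ≤-refl
  where open NonemptySpider (suc N)
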